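{- If $G$ is a simple oriented hypergraph with vertices $v_1,\dots,v_n$ and $k$ is a non-negative integer, then $X_{(G,V,V,k)}=A_G^k$.
   Context: An oriented hypergraph $G=(V,E,\mathcal{I},\sigma)$ consists of disjoint finite sets $V$, $E$, an incidence function $\iota:V\times E\to\mathbb{Z}_{\ge0}$, incidences $(v,e,k)$ with $1\le k\le\iota(v,e)$, and $\sigma:\mathcal{I}\to\{+1,-1\}$. Simple means $\iota(v,e)\le1$; write $(v,e)$ for $(v,e,1)$. In the simple case, $sgn_e(v,w)=-\sigma(v,e)\sigma(w,e)$ if $(v,e),(w,e)$ are distinct incidences and $0$ otherwise, and $A_G=[a_{ij}]$ with $a_{ij}=\sum_e sgn_e(v_i,v_j)$. A walk is a sequence $W=a_0,i_1,a_1,\dots,i_n,a_n$ where $a_0,\dots,a_n$ alternate between vertices and edges, each $i_h$ is an incidence containing $a_{h-1}$ and $a_h$, and $i_{2h-1}\ne i_{2h}$ for all $h$ with $2h\le n$; its length is $n/2$ and its sign is $(-1)^{\lfloor n/2\rfloor}\prod_{h=1}^n\sigma(i_h)$. $w^{\pm}(a,b;k)$ is the number of positive walks of length $k$ from $a$ to $b$ minus the number of negative ones. For $A_1,A_2\in\{V,E\}$, the $k$-walk matrix $X_{(G,A_1,A_2,k)}$ is the $A_1\times A_2$ matrix with $(a_i,a_j)$-entry $w^{\pm}(a_i,a_j;k)$ ($k$ a nonnegative integer if $A_1=A_2$, a nonnegative half-integer otherwise). -}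

module Defs where

open import Data.Nat as ℕ using (ℕ; zero; suc; _≤_; _≡ᵇ_)
open import Data.Integer as ℤ using (ℤ; 0ℤ; 1ℤ; -1ℤ; _+_; _*_; -_)
open import Data.Fin as Fin using (Fin; toℕ)
open import Data.Fin.Properties using () renaming (_≟_ to _≟F_)
open import Data.Product using (Σ; _×_; _,_; proj₁; proj₂)
open import Data.Vec using (Vec; []; _∷_)
open import Data.Bool using (Bool; true; false; _∧_; if_then_else_)
open import Data.Sign using (Sign) renaming (+ to s+; - to s-)
open import Relation.Nullary.Decidable using (⌊_⌋)
open import Relation.Nullary using (yes; no)
open import Relation.Binary.PropositionalEquality using (_≡_)

sumFin : (n : ℕ) → (Fin n → ℤ) → ℤ
sumFin zero    f = 0ℤ
sumFin (suc n) f = f Fin.zero + sumFin n (λ i → f (Fin.suc i))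

signℤ : Sign → ℤ
signℤ s+ = 1ℤ
signℤ s- = -1ℤ

-- Oriented hypergraph with vertex set Fin n and edge set Fin m.
-- ι v e = number of incidences between v and e; the incidences of (v,e)
-- are indexed by Fin (ι v e) (index k ↦ incidence (v,e,k+1)).
record OHG (n m : ℕ) : Set where
  field
    ι : Fin n → Fin m → ℕ
    σ : (v : Fin n) (e : Fin m) → Fin (ι v e) → Sign

module _ {n m : ℕ} (G : OHG n m) where
  open OHG G

  Simple : Set
  Simple = ∀ v e → ι v e ≤ 1

  Inc : Set
  Inc = Σ (Fin n × Fin m) λ p → Fin (ι (proj₁ p) (proj₂ p))

  vtx : Inc → Fin n
  vtx i = proj₁ (proj₁ i)

  edg : Inc → Fin m
  edg i = proj₂ (proj₁ i)

  σI : Inc → ℤ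
  σI ((v , e) , k) = signℤ (σ v e k)

  incEq : Inc → Inc → Bool
  incEq ((v , e) , k) ((v' , e') , k') =
    ⌊ v ≟F v' ⌋ ∧ ⌊ e ≟F e' ⌋ ∧ (toℕ k ≡ᵇ toℕ k')

  sumInc : (Inc → ℤ) → ℤ
  sumInc f = sumFin n λ v → sumFin m λ e → sumFin (ι v e) λ k → f ((v , e) , k)

  sumSeq : (L : ℕ) → (Vec (Inc × Inc) L → ℤ) → ℤ
  sumSeq zero    f = f []
  sumSeq (suc L) f = sumInc λ x → sumInc λ y → sumSeq L (λ xs → f ((x , y) ∷ xs))

  -- A vertex-to-vertex walk of length k from a to b,
  --   a = a₀, i₁, a₁, i₂, a₂, …, i_{2k}, a_{2k} = b,
  -- is determined by its incidence sequence, given as k pairs (i_{2h-1}, i_{2h}).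
  -- isWalk a b s checks: i₁ contains a (or a = b if k = 0); i_{2h-1}, i_{2h}
  -- contain the same edge a_{2h-1} and are distinct; i_{2h}, i_{2h+1} contain
  -- the same vertex a_{2h}; i_{2k} contains b.
  isWalk : Fin n → Fin n → ∀ {L} → Vec (Inc × Inc) L → Bool
  isWalk a b [] = ⌊ a ≟F b ⌋
  isWalk a b ((x , y) ∷ rest) =
    ⌊ vtx x ≟F a ⌋ ∧ ⌊ edg x ≟F edg y ⌋ ∧ Data.Bool.not (incEq x y)
      ∧ isWalk (vtx y) b rest
    where import Data.Bool

  prodσ : ∀ {L} → Vec (Inc × Inc) L → ℤ
  prodσ [] = 1ℤ
  prodσ ((x , y) ∷ rest) = σI x * σI y * prodσ rest

  negPow : ℕ → ℤ
  negPow zero = 1ℤ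
  negPow (suc L) = - negPow L

  -- sign of a walk with 2L incidences: (-1)^⌊2L/2⌋ ∏ σ(i_h)
  walkSign : ∀ {L} → Vec (Inc × Inc) L → ℤ
  walkSign {L} s = negPow L * prodσ s

  wpm : Fin n → Fin n → ℕ → ℤ
  wpm a b k = sumSeq k λ s → if isWalk a b s then walkSign s else 0ℤ

  X-VV : ℕ → Fin n → Fin n → ℤ
  X-VV k a b = wpm a b k

  -- sgn_e(v,w) in the simple case: the incidences (v,e,1), (w,e,1)
  -- exist and are distinct (i.e. v ≠ w)
  sgn : Fin m → Fin n → Fin n → ℤ
  sgn e v w with ι v e | σ v e | ι w e | σ w e | v ≟F w
  ... | suc _ | sv | suc _ | sw | no _ =
        - (signℤ (sv Fin.zero) * signℤ (sw Fin.zero))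
  ... | _ | _ | _ | _ | _ = 0ℤ

  adj : Fin n → Fin n → ℤ
  adj v w = sumFin m λ e → sgn e v w

Mat : ℕ → Set
Mat n = Fin n → Fin n → ℤ

idMat : ∀ {n} → Mat n
idMat i j = if ⌊ i ≟F j ⌋ then 1ℤ else 0ℤ

_⊗_ : ∀ {n} → Mat n → Mat n → Mat n
_⊗_ {n} A B i j = sumFin n λ l → A i l * B l j

_^M_ : ∀ {n} → Mat n → ℕ → Mat n
A ^M zero = idMat
A ^M suc k = A ⊗ (A ^M k)

_≋_ : ∀ {n} → Mat n → Mat n → Set
A ≋ B = ∀ i j → A i j ≡ B i j

module Submission where

-- Write τ(a; x, y) for the signed weight of the first step of
-- a walk out of vertex a: x is an incidence at a, y a different incidence
-- on the same edge, and the step contributes −σ(x)σ(y).  Peeling the first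
-- step off every walk of length k+1 gives the recursion
--     w±(a, b; k+1) = Σ_{x,y} τ(a; x, y) · w±(vtx y, b; k).
-- For a simple hypergraph, grouping the pairs (x, y) by the edge e of x and
-- the vertex w of y shows that Σ_{x,y} τ(a; x, y) · W(vtx y) equals
-- Σ_w A_G(a, w) · W(w) for every W : V → ℤ: only x = (a, e) contributes, y
-- must be (w, e), and −σ(a,e)σ(w,e) is sgn_e(a, w) (with w = a excluded,
-- since the two incidences must differ).  The theorem then follows by
-- induction on k, with w±(a, b; 0) = δ_{ab}.

open import Defs
open import Data.Nat using (ℕ; zero; suc; _≤_; s≤s; _≡ᵇ_)
open import Data.Integer using (ℤ; 0ℤ; _+_; _*_; -_)
import Data.Integer.Properties as ℤP
open import Data.Fin using (Fin; toℕ) renaming (zero to fzero; suc to fsuc)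
open import Data.Fin.Properties using (suc-injective) renaming (_≟_ to _≟F_)
open import Data.Product using (_×_; _,_)
open import Data.Vec using (Vec; _∷_)
open import Data.Bool using (true; false; _∧_; not; if_then_else_)
open import Data.Bool.Properties using (∧-assoc)
open import Data.Sign using (Sign)
open import Data.Empty using (⊥-elim)
open import Function using (_∘_)
open import Relation.Nullary using (¬_; Dec; yes; no)
open import Relation.Nullary.Decidable using (⌊_⌋)
open import Relation.Binary.PropositionalEquality
open import Algebra.Properties.Semiring.Sum ℤP.+-*-semiring
  using (sum; sum-cong-≗; sum-replicate-zero; *-distribˡ-sum; ∑-comm)
open import Data.Integer.Solver using (module +-*-Solver)
open +-*-Solver using (solve; _:*_; :-_; _:=_)

sumFin≡sum : ∀ n (f : Fin n → ℤ) → sumFin n f ≡ sum f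
sumFin≡sum zero    f = refl
sumFin≡sum (suc n) f = cong (f fzero +_) (sumFin≡sum n (λ i → f (fsuc i)))

sumFin-cong : ∀ n {f g : Fin n → ℤ} → (∀ i → f i ≡ g i) → sumFin n f ≡ sumFin n g
sumFin-cong n {f} {g} f≗g =
  trans (sumFin≡sum n f) (trans (sum-cong-≗ f≗g) (sym (sumFin≡sum n g)))

sumFin-zero : ∀ n {f : Fin n → ℤ} → (∀ i → f i ≡ 0ℤ) → sumFin n f ≡ 0ℤ
sumFin-zero n {f} f≗0 =
  trans (sumFin≡sum n f) (trans (sum-cong-≗ f≗0) (sum-replicate-zero n))

sumFin-*ˡ : ∀ n c (f : Fin n → ℤ) → c * sumFin n f ≡ sumFin n (λ i → c * f i)
sumFin-*ˡ n c f = begin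
  c * sumFin n f              ≡⟨ cong (c *_) (sumFin≡sum n f) ⟩
  c * sum f                   ≡⟨ *-distribˡ-sum c f ⟩
  sum (λ i → c * f i)         ≡⟨ sumFin≡sum n (λ i → c * f i) ⟨
  sumFin n (λ i → c * f i)    ∎
  where open ≡-Reasoning

sumFin-*ʳ : ∀ n c (f : Fin n → ℤ) → sumFin n f * c ≡ sumFin n (λ i → f i * c)
sumFin-*ʳ n c f = begin
  sumFin n f * c              ≡⟨ ℤP.*-comm (sumFin n f) c ⟩
  c * sumFin n f              ≡⟨ sumFin-*ˡ n c f ⟩
  sumFin n (λ i → c * f i)    ≡⟨ sumFin-cong n (λ i → ℤP.*-comm c (f i)) ⟩
  sumFin n (λ i → f i * c)    ∎
  where open ≡-Reasoning

sumFin-comm : ∀ n p (f : Fin n → Fin p → ℤ) →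
  sumFin n (λ i → sumFin p (f i)) ≡ sumFin p (λ j → sumFin n (λ i → f i j))
sumFin-comm n p f = begin
  sumFin n (λ i → sumFin p (f i))          ≡⟨ sumFin-cong n (λ i → sumFin≡sum p (f i)) ⟩
  sumFin n (λ i → sum (f i))               ≡⟨ sumFin≡sum n _ ⟩
  sum (λ i → sum (f i))                    ≡⟨ ∑-comm f ⟩
  sum (λ j → sum (λ i → f i j))            ≡⟨ sumFin≡sum p _ ⟨
  sumFin p (λ j → sum (λ i → f i j))       ≡⟨ sumFin-cong p (λ j → sumFin≡sum n (λ i → f i j)) ⟨
  sumFin p (λ j → sumFin n (λ i → f i j))  ∎
  where open ≡-Reasoning

sumFin-delta : ∀ n (a : Fin n) (f : Fin n → ℤ) →
  (∀ i → ¬ i ≡ a → f i ≡ 0ℤ) → sumFin n f ≡ f a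
sumFin-delta (suc n) fzero f off =
  trans (cong (f fzero +_) (sumFin-zero n (λ i → off (fsuc i) (λ ()))))
        (ℤP.+-identityʳ (f fzero))
sumFin-delta (suc n) (fsuc a) f off =
  trans (cong₂ _+_ (off fzero (λ ()))
                   (sumFin-delta n a (λ i → f (fsuc i))
                      (λ i i≢a → off (fsuc i) (i≢a ∘ suc-injective))))
        (ℤP.+-identityˡ (f (fsuc a)))

index-unique : ∀ {p} → p ≤ 1 → (k k' : Fin p) → (toℕ k ≡ᵇ toℕ k') ≡ true
index-unique {suc zero}    _          fzero fzero = refl
index-unique {suc (suc _)} (s≤s ()) _     _

-- The value of sgn_e(v, w) for v ≠ w, as a function of the incidence data
-- of (v, e) and (w, e): −σ(v,e,1)σ(w,e,1) when both incidences exist.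
pairSign : (p : ℕ) → (Fin p → Sign) → (q : ℕ) → (Fin q → Sign) → ℤ
pairSign zero    _  _       _  = 0ℤ
pairSign (suc _) _  zero    _  = 0ℤ
pairSign (suc _) sv (suc _) sw = - (signℤ (sv fzero) * signℤ (sw fzero))

sum-pairSign : ∀ p q (sv : Fin p → Sign) (sw : Fin q → Sign) → p ≤ 1 → q ≤ 1 →
  (W : ℤ) →
  sumFin p (λ k → sumFin q (λ k' → - (signℤ (sv k) * signℤ (sw k')) * W))
    ≡ pairSign p sv q sw * W
sum-pairSign zero          q             sv sw _        _        W = sym (ℤP.*-zeroˡ W)
sum-pairSign (suc zero)    zero          sv sw _        _        W = sym (ℤP.*-zeroˡ W)
sum-pairSign (suc zero)    (suc zero)    sv sw _        _        W =
  trans (ℤP.+-identityʳ _) (ℤP.+-identityʳ _)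
sum-pairSign (suc (suc _)) q             sv sw (s≤s ()) _        W
sum-pairSign (suc zero)    (suc (suc _)) sv sw _        (s≤s ()) W

guarded-product : ∀ b₁ b₂ {A c B : ℤ} → A ≡ c * B →
  (if b₁ ∧ b₂ then A else 0ℤ) ≡ (if b₁ then c else 0ℤ) * (if b₂ then B else 0ℤ)
guarded-product true  true           A≡cB = A≡cB
guarded-product true  false  {c = c} _    = sym (ℤP.*-zeroʳ c)
guarded-product false b₂     {B = B} _    = sym (ℤP.*-zeroˡ (if b₂ then B else 0ℤ))

module _ {n m : ℕ} (G : OHG n m) where
  open OHG G

  sumInc-cong : {f g : Inc G → ℤ} → (∀ i → f i ≡ g i) → sumInc G f ≡ sumInc G g
  sumInc-cong f≗g = sumFin-cong n (λ v → sumFin-cong m (λ e →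
    sumFin-cong (ι v e) (λ k → f≗g ((v , e) , k))))

  sumInc-zero : {f : Inc G → ℤ} → (∀ i → f i ≡ 0ℤ) → sumInc G f ≡ 0ℤ
  sumInc-zero f≗0 = sumFin-zero n (λ v → sumFin-zero m (λ e →
    sumFin-zero (ι v e) (λ k → f≗0 ((v , e) , k))))

  sumInc-*ˡ : ∀ c (f : Inc G → ℤ) → c * sumInc G f ≡ sumInc G (λ i → c * f i)
  sumInc-*ˡ c f = trans (sumFin-*ˡ n c _) (sumFin-cong n (λ v →
    trans (sumFin-*ˡ m c _) (sumFin-cong m (λ e → sumFin-*ˡ (ι v e) c _))))

  sumInc-at-vertex : ∀ a (f : Inc G → ℤ) → (∀ v e k → ¬ v ≡ a → f ((v , e) , k) ≡ 0ℤ) →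
    sumInc G f ≡ sumFin m (λ e → sumFin (ι a e) (λ k → f ((a , e) , k)))
  sumInc-at-vertex a f off = sumFin-delta n a _ (λ v v≢a →
    sumFin-zero m (λ e → sumFin-zero (ι v e) (λ k → off v e k v≢a)))

  sumInc-at-edge : ∀ e (f : Inc G → ℤ) → (∀ v e' k → ¬ e' ≡ e → f ((v , e') , k) ≡ 0ℤ) →
    sumInc G f ≡ sumFin n (λ v → sumFin (ι v e) (λ k → f ((v , e) , k)))
  sumInc-at-edge e f off = sumFin-cong n (λ v → sumFin-delta m e _ (λ e' e'≢e →
    sumFin-zero (ι v e') (λ k → off v e' k e'≢e)))

  sumSeq-cong : ∀ L {f g : Vec (Inc G × Inc G) L → ℤ} → (∀ s → f s ≡ g s) →
    sumSeq G L f ≡ sumSeq G L g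
  sumSeq-cong zero    f≗g = f≗g _
  sumSeq-cong (suc L) f≗g = sumInc-cong (λ x → sumInc-cong (λ y →
    sumSeq-cong L (λ s → f≗g ((x , y) ∷ s))))

  sumSeq-*ˡ : ∀ L c (f : Vec (Inc G × Inc G) L → ℤ) →
    c * sumSeq G L f ≡ sumSeq G L (λ s → c * f s)
  sumSeq-*ˡ zero    c f = refl
  sumSeq-*ˡ (suc L) c f = trans (sumInc-*ˡ c _) (sumInc-cong (λ x →
    trans (sumInc-*ˡ c _) (sumInc-cong (λ y → sumSeq-*ˡ L c _))))

  walkWeight : Fin n → Fin n → ∀ {L} → Vec (Inc G × Inc G) L → ℤ
  walkWeight a b s = if isWalk G a b s then walkSign G s else 0ℤ

  stepWeight : Fin n → Inc G → Inc G → ℤ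
  stepWeight a x y =
    if ⌊ vtx G x ≟F a ⌋ ∧ ⌊ edg G x ≟F edg G y ⌋ ∧ not (incEq G x y)
    then - (σI G x * σI G y) else 0ℤ

  -- A walk's weight factors as its first step times the weight of the rest;
  -- the factor −1 accounts for the extra unit of length.
  walkWeight-cons : ∀ a b x y {L} (s : Vec (Inc G × Inc G) L) →
    walkWeight a b ((x , y) ∷ s) ≡ stepWeight a x y * walkWeight (vtx G y) b s
  walkWeight-cons a b x y {L} s =
    trans (cong (λ c → if c then walkSign G ((x , y) ∷ s) else 0ℤ) regroup)
          (guarded-product (atA ∧ sameEdge ∧ distinct) rest
            (solve 4 (λ N u v P → (:- N) :* ((u :* v) :* P) := (:- (u :* v)) :* (N :* P))
               refl (negPow G L) (σI G x) (σI G y) (prodσ G s)))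
    where
    atA      = ⌊ vtx G x ≟F a ⌋
    sameEdge = ⌊ edg G x ≟F edg G y ⌋
    distinct = not (incEq G x y)
    rest     = isWalk G (vtx G y) b s
    regroup : atA ∧ (sameEdge ∧ (distinct ∧ rest)) ≡ (atA ∧ sameEdge ∧ distinct) ∧ rest
    regroup = trans (cong (atA ∧_) (sym (∧-assoc sameEdge distinct rest)))
                    (sym (∧-assoc atA (sameEdge ∧ distinct) rest))

  wpm-suc : ∀ a b k → wpm G a b (suc k) ≡
    sumInc G (λ x → sumInc G (λ y → stepWeight a x y * wpm G (vtx G y) b k))
  wpm-suc a b k = sumInc-cong (λ x → sumInc-cong (λ y →
    trans (sumSeq-cong k (walkWeight-cons a b x y))
          (sym (sumSeq-*ˡ k (stepWeight a x y) (walkWeight (vtx G y) b)))))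

  stepWeight-off-vertex : ∀ a x y → ¬ vtx G x ≡ a → stepWeight a x y ≡ 0ℤ
  stepWeight-off-vertex a x y x∉a with vtx G x ≟F a
  ... | yes x∈a = ⊥-elim (x∉a x∈a)
  ... | no _    = refl

  stepWeight-off-edge : ∀ a e k w e' k' → ¬ e' ≡ e →
    stepWeight a ((a , e) , k) ((w , e') , k') ≡ 0ℤ
  stepWeight-off-edge a e k w e' k' e'≢e with a ≟F a | e ≟F e'
  ... | _     | yes e≡e' = ⊥-elim (e'≢e (sym e≡e'))
  ... | yes _ | no _     = refl
  ... | no _  | no _     = refl

  -- In a simple hypergraph, the two incidences of a step at the same vertex
  -- and edge would coincide, so such a step has weight 0.
  stepWeight-loop : Simple G → ∀ a e k k' → stepWeight a ((a , e) , k) ((a , e) , k') ≡ 0ℤ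
  stepWeight-loop simple a e k k' with a ≟F a | e ≟F e
  ... | yes _ | yes _ rewrite index-unique (simple a e) k k' = refl
  ... | yes _ | no _  = refl
  ... | no _  | _     = refl

  stepWeight-across : ∀ a e k w k' → ¬ a ≡ w →
    stepWeight a ((a , e) , k) ((w , e) , k') ≡ - (signℤ (σ a e k) * signℤ (σ w e k'))
  stepWeight-across a e k w k' a≢w with a ≟F a | e ≟F e | a ≟F w
  ... | yes _ | yes _ | no _     = refl
  ... | no a≢a | _    | _        = ⊥-elim (a≢a refl)
  ... | yes _ | no e≢e | _       = ⊥-elim (e≢e refl)
  ... | yes _ | yes _ | yes a≡w  = ⊥-elim (a≢w a≡w)

  sgn-across : ∀ e v w → ¬ v ≡ w → sgn G e v w ≡ pairSign (ι v e) (σ v e) (ι w e) (σ w e)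
  sgn-across e v w v≢w with ι v e | σ v e | ι w e | σ w e | v ≟F w
  ... | zero  | _ | _     | _ | _       = refl
  ... | suc _ | _ | zero  | _ | _       = refl
  ... | suc _ | _ | suc _ | _ | no _    = refl
  ... | suc _ | _ | suc _ | _ | yes v≡w = ⊥-elim (v≢w v≡w)

  sgn-loop : ∀ e v → sgn G e v v ≡ 0ℤ
  sgn-loop e v with ι v e | σ v e | v ≟F v
  ... | zero  | _ | _       = refl
  ... | suc _ | _ | yes _   = refl
  ... | suc _ | _ | no v≢v  = ⊥-elim (v≢v refl)

  edge-contribution : Simple G → ∀ a e w (W : ℤ) →
    sumFin (ι a e) (λ k → sumFin (ι w e) (λ k' →
      stepWeight a ((a , e) , k) ((w , e) , k') * W))
      ≡ sgn G e a w * W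
  edge-contribution simple a e w W = by-cases (a ≟F w)
    where
    contribution : Fin n → Set
    contribution u = sumFin (ι a e) (λ k → sumFin (ι u e) (λ k' →
      stepWeight a ((a , e) , k) ((u , e) , k') * W)) ≡ sgn G e a u * W
    by-cases : Dec (a ≡ w) → contribution w
    by-cases (yes a≡w) = subst contribution a≡w
      (trans (sumFin-zero (ι a e) (λ k → sumFin-zero (ι a e) (λ k' →
                trans (cong (_* W) (stepWeight-loop simple a e k k')) (ℤP.*-zeroˡ W))))
             (sym (trans (cong (_* W) (sgn-loop e a)) (ℤP.*-zeroˡ W))))
    by-cases (no a≢w) =
      trans (sumFin-cong (ι a e) (λ k → sumFin-cong (ι w e) (λ k' →
               cong (_* W) (stepWeight-across a e k w k' a≢w))))
            (trans (sum-pairSign (ι a e) (ι w e) (σ a e) (σ w e) (simple a e) (simple w e) W)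
                   (cong (_* W) (sym (sgn-across e a w a≢w))))

  one-step : Simple G → ∀ a (W : Fin n → ℤ) →
    sumInc G (λ x → sumInc G (λ y → stepWeight a x y * W (vtx G y)))
      ≡ sumFin n (λ w → adj G a w * W w)
  one-step simple a W = begin
    sumInc G (λ x → sumInc G (λ y → stepWeight a x y * W (vtx G y)))
      ≡⟨ sumInc-at-vertex a _ (λ v e k v≢a → sumInc-zero (λ y →
           vanish y (stepWeight-off-vertex a ((v , e) , k) y v≢a))) ⟩
    sumFin m (λ e → sumFin (ι a e) (λ k → sumInc G (λ y → step e k y)))
      ≡⟨ sumFin-cong m (λ e → sumFin-cong (ι a e) (λ k → sumInc-at-edge e _
           (λ w e' k' e'≢e → vanish ((w , e') , k') (stepWeight-off-edge a e k w e' k' e'≢e)))) ⟩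
    sumFin m (λ e → sumFin (ι a e) (λ k → sumFin n (λ w →
      sumFin (ι w e) (λ k' → step e k ((w , e) , k')))))
      ≡⟨ sumFin-cong m (λ e → sumFin-comm (ι a e) n _) ⟩
    sumFin m (λ e → sumFin n (λ w → sumFin (ι a e) (λ k →
      sumFin (ι w e) (λ k' → step e k ((w , e) , k')))))
      ≡⟨ sumFin-cong m (λ e → sumFin-cong n (λ w → edge-contribution simple a e w (W w))) ⟩
    sumFin m (λ e → sumFin n (λ w → sgn G e a w * W w))
      ≡⟨ sumFin-comm m n _ ⟩
    sumFin n (λ w → sumFin m (λ e → sgn G e a w * W w))
      ≡⟨ sumFin-cong n (λ w → sumFin-*ʳ m (W w) (λ e → sgn G e a w)) ⟨
    sumFin n (λ w → adj G a w * W w)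
      ∎
    where
    open ≡-Reasoning
    step : ∀ e → Fin (ι a e) → Inc G → ℤ
    step e k y = stepWeight a ((a , e) , k) y * W (vtx G y)
    vanish : ∀ y {t : ℤ} → t ≡ 0ℤ → t * W (vtx G y) ≡ 0ℤ
    vanish y t≡0 = trans (cong (_* W (vtx G y)) t≡0) (ℤP.*-zeroˡ (W (vtx G y)))

lemma5p1 : ∀ {n m : ℕ} (G : OHG n m) → Simple G → (k : ℕ) →
    X-VV G k ≋ (adj G ^M k)
lemma5p1 G simple zero    a b = refl
lemma5p1 G simple (suc k) a b = begin
  wpm G a b (suc k)
    ≡⟨ wpm-suc G a b k ⟩
  sumInc G (λ x → sumInc G (λ y → stepWeight G a x y * wpm G (vtx G y) b k))
    ≡⟨ sumInc-cong G (λ x → sumInc-cong G (λ y →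
         cong (stepWeight G a x y *_) (lemma5p1 G simple k (vtx G y) b))) ⟩
  sumInc G (λ x → sumInc G (λ y → stepWeight G a x y * (adj G ^M k) (vtx G y) b))
    ≡⟨ one-step G simple a (λ w → (adj G ^M k) w b) ⟩
  (adj G ^M suc k) a b
    ∎
  where open ≡-Reasoning
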